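{- For every integer $l \geq 3$, $\sigma^{ - }(P(2l+1,2)) = 7$.
   Context: For $n \geq 3$, $k \geq 1$ with $2k<n$, the generalized Petersen graph $P(n,k)$ has vertex set $\{u_i, v_i : i=0,1,\dots,n-1\}$ and edge set $\{u_iu_{i+1},\ u_iv_i,\ v_iv_{i+k} : i=0,\dots,n-1\}$, subscripts read modulo $n$. For a simple connected graph $G$ of order $N$, the \textbf{rna} number $\sigma^{ - }(G)$ is the minimum, over all bijections $f: V(G)\to\{1,2,\dots,N\}$, of the number of edges $uv$ of $G$ such that $f(u)$ and $f(v)$ have different parity. -}

module Defs where

open import Data.Nat using (ℕ; zero; suc; _+_; _*_; _≤_; _<_; NonZero)
open import Data.Nat.DivMod using (_mod_; _%_)
open import Data.Fin using (Fin; toℕ)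
open import Data.Bool using (Bool; true; false; _xor_)
open import Data.List using (List; []; _∷_; concatMap; allFin; length; filter; _++_)
open import Data.Sum using (_⊎_; inj₁; inj₂)
open import Data.Product using (_×_; _,_; Σ; ∃)
open import Function.Bundles using (_↔_; Inverse)
open import Relation.Binary.PropositionalEquality using (_≡_)

odd : ℕ → Bool
odd zero = false
odd (suc n) = Data.Bool.not (odd n)
  where import Data.Bool

-- Vertices of the generalized Petersen graph P(n,k):
-- inj₁ i is u_i, inj₂ i is v_i  (i : Fin n).
PVertex : ℕ → Set
PVertex n = Fin n ⊎ Fin n

_+ₘ_ : ∀ {n} .{{_ : NonZero n}} → Fin n → ℕ → Fin n
_+ₘ_ {n} i j = (toℕ i + j) mod n

-- The edge list of P(n,k): for each i, the edges u_i u_{i+1}, u_i v_i, v_i v_{i+k}.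
-- (For 2k < n these 3n edges are pairwise distinct, so this list is exactly
-- the edge set, each edge listed once.)
PEdges : (n k : ℕ) .{{_ : NonZero n}} → List (PVertex n × PVertex n)
PEdges n k = concatMap
  (λ i → (inj₁ i , inj₁ (i +ₘ 1)) ∷ (inj₁ i , inj₂ i) ∷ (inj₂ i , inj₂ (i +ₘ k)) ∷ [])
  (allFin n)

-- A labeling of a graph with vertex type V of order N: a bijection V ↔ Fin N,
-- where the vertex x receives label toℕ (f x) + 1 ∈ {1,…,N}.
Labeling : Set → ℕ → Set
Labeling V N = V ↔ Fin N

label : ∀ {V N} → Labeling V N → V → ℕ
label f x = suc (toℕ (Inverse.to f x))

oddEdges : ∀ {V N} → List (V × V) → Labeling V N → ℕ
oddEdges [] f = 0
oddEdges ((x , y) ∷ es) f with odd (label f x) xor odd (label f y)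
... | true = suc (oddEdges es f)
... | false = oddEdges es f

RnaNumberIs : (V : Set) (N : ℕ) → List (V × V) → ℕ → Set
RnaNumberIs V N E m =
  (Σ (Labeling V N) λ f → oddEdges E f ≡ m) × ((f : Labeling V N) → m ≤ oddEdges E f)

PetersenRnaIs : (n k : ℕ) .{{_ : NonZero n}} → ℕ → Set
PetersenRnaIs n k m = RnaNumberIs (PVertex n) (n + n) (PEdges n k) m

module Submission where

-- Let p m and q m be the parities of the labels of u_m and v_m. The odd edges of P(n,2) are
-- O changes of p around the outer cycle, I changes of q around the inner cycle m ↦ m + 2
-- (a single cycle, n being odd) and X spokes where p and q differ. O and I are even and,
-- since exactly n labels are odd, X ≡ n is odd. If O = 0 or I = 0 then p or q is constant
-- and X = n ≥ 7. Otherwise parity leaves O = 2, X = 1, I = 2 as the only total below 7.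
-- Then p ∧ q has l elements, so q and not ∘ q both have at least l ≥ 3 ones and at most
-- O + 2X = 4 changes around the outer cycle: q is true at some i, i + 1 and false at some
-- j, j + 1. But with I = 2, q is true on an arc b, b + 2, …, b + 2l with b ∈ {i, i + 1},
-- and such an arc meets every pair j, j + 1.
-- Conversely, labelling u_i by 1 + (2i mod n) and v_i by n + 1 + ((2i + 1) mod n) makes p
-- true exactly on [0, l] and q exactly on [0, l), giving O = 2, X = 1 and I = 4.

open import Defs
open import Data.Nat using (_≟_; _≤?_; ℕ; zero; suc; _+_; _*_; _∸_; _≤_; _<_; z≤n; s≤s; z<s; s<s; NonZero)
open import Data.Nat.Properties
open import Data.Nat.DivMod using (_mod_; _%_; _/_; [m+n]%n≡m%n; [m+kn]%n≡m%n; m<n⇒m%n≡m; m≡m%n+[m/n]*n)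
open import Data.Fin as Fin using (Fin; toℕ; splitAt; _↑ˡ_; _↑ʳ_)
open import Data.Fin.Properties using (toℕ-injective; toℕ-fromℕ<; toℕ-↑ˡ; toℕ-↑ʳ; toℕ<n; splitAt-↑ˡ; splitAt-↑ʳ; +↔⊎)
open import Data.List using (List; []; _∷_; _++_; concatMap; tabulate)
open import Function.Bundles using (_↔_; mk↔ₛ′)
open import Function.Properties.Inverse using (↔-sym; ↔-trans)
open import Data.Sum.Function.Propositional using (_⊎-↔_)
open import Algebra.Properties.CommutativeMonoid.Sum +-0-commutativeMonoid using (sum; sum-permute; sum-cong-≗)
open import Data.Bool using (Bool; true; false; not; _∧_; _xor_)
open import Data.Bool.Properties using (not-involutive; not-distribˡ-xor; xor-same; xor-comm; xor-assoc; xor-identityʳ; xor-annihilates-not; ∧-comm)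
open import Data.Product using (∃-syntax; _×_; _,_)
open import Data.Sum as Sum using (_⊎_; inj₁; inj₂; [_,_])
open import Data.Empty using (⊥; ⊥-elim)
open import Function using (_∘_)
open import Relation.Binary.PropositionalEquality using (_≡_; _≢_; refl; sym; trans; cong; cong₂; subst; module ≡-Reasoning)
open import Relation.Nullary using (¬_; Dec; yes; no)
open import Data.Nat.Tactic.RingSolver using (solve-∀)
open import Algebra.Properties.CommutativeSemigroup +-commutativeSemigroup using (interchange; x∙yz≈y∙xz; xy∙z≈xz∙y)

⟦_⟧ : Bool → ℕ
⟦ true ⟧ = 1
⟦ false ⟧ = 0

∑ : ℕ → (ℕ → ℕ) → ℕ
∑ zero h = 0
∑ (suc n) h = h 0 + ∑ n (h ∘ suc)

∑-cong : ∀ n {h g : ℕ → ℕ} → (∀ m → m < n → h m ≡ g m) → ∑ n h ≡ ∑ n g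
∑-cong zero e = refl
∑-cong (suc n) e = cong₂ _+_ (e 0 z<s) (∑-cong n (λ m m<n → e (suc m) (s<s m<n)))

∑-mono-≤ : ∀ n {h g : ℕ → ℕ} → (∀ m → m < n → h m ≤ g m) → ∑ n h ≤ ∑ n g
∑-mono-≤ zero e = z≤n
∑-mono-≤ (suc n) e = +-mono-≤ (e 0 z<s) (∑-mono-≤ n (λ m m<n → e (suc m) (s<s m<n)))

∑-distrib-+ : ∀ n (h g : ℕ → ℕ) → ∑ n (λ m → h m + g m) ≡ ∑ n h + ∑ n g
∑-distrib-+ zero h g = refl
∑-distrib-+ (suc n) h g = begin
  (h 0 + g 0) + ∑ n (λ m → h (suc m) + g (suc m)) ≡⟨ cong (h 0 + g 0 +_) (∑-distrib-+ n (h ∘ suc) (g ∘ suc)) ⟩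
  (h 0 + g 0) + (∑ n (h ∘ suc) + ∑ n (g ∘ suc))   ≡⟨ interchange (h 0) (g 0) _ _ ⟩
  (h 0 + ∑ n (h ∘ suc)) + (g 0 + ∑ n (g ∘ suc))   ∎
  where open ≡-Reasoning

∑-distribˡ-* : ∀ n c (h : ℕ → ℕ) → ∑ n (λ m → c * h m) ≡ c * ∑ n h
∑-distribˡ-* zero c h = sym (*-zeroʳ c)
∑-distribˡ-* (suc n) c h =
  trans (cong (c * h 0 +_) (∑-distribˡ-* n c (h ∘ suc))) (sym (*-distribˡ-+ c (h 0) _))

∑-const : ∀ n c → ∑ n (λ _ → c) ≡ n * c
∑-const zero c = refl
∑-const (suc n) c = cong (c +_) (∑-const n c)

∑-const-on : ∀ k (h : ℕ → ℕ) c → (∀ m → m < k → h m ≡ c) → ∑ k h ≡ k * c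
∑-const-on k h c constant = trans (∑-cong k constant) (∑-const k c)

∑-++ : ∀ a b (h : ℕ → ℕ) → ∑ (a + b) h ≡ ∑ a h + ∑ b (λ m → h (a + m))
∑-++ zero b h = refl
∑-++ (suc a) b h = trans (cong (h 0 +_) (∑-++ a b (h ∘ suc))) (sym (+-assoc (h 0) _ _))

∑-last : ∀ n (h : ℕ → ℕ) → ∑ (suc n) h ≡ ∑ n h + h n
∑-last zero h = +-comm (h 0) 0
∑-last (suc n) h = trans (cong (h 0 +_) (∑-last n (h ∘ suc))) (sym (+-assoc (h 0) _ _))

∑-rotate : ∀ n (h : ℕ → ℕ) → (∀ m → h (m + n) ≡ h m) → ∀ i → ∑ n (λ m → h (m + i)) ≡ ∑ n h
∑-rotate n h periodic zero = ∑-cong n (λ m _ → cong h (+-identityʳ m))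
∑-rotate n h periodic (suc i) = begin
  ∑ n (λ m → h (m + suc i))  ≡⟨ ∑-cong n (λ m _ → cong h (+-suc m i)) ⟩
  ∑ n (g ∘ suc)              ≡⟨ +-cancelʳ-≡ _ _ _ rotated-once ⟩
  ∑ n g                      ≡⟨ ∑-rotate n h periodic i ⟩
  ∑ n h                      ∎
  where
  open ≡-Reasoning
  g : ℕ → ℕ
  g m = h (m + i)
  rotated-once : ∑ n (g ∘ suc) + g 0 ≡ ∑ n g + g 0
  rotated-once = begin
    ∑ n (g ∘ suc) + g 0  ≡⟨ +-comm _ (g 0) ⟩
    ∑ (suc n) g          ≡⟨ ∑-last n g ⟩
    ∑ n g + h (n + i)    ≡⟨ cong (λ x → ∑ n g + h x) (+-comm n i) ⟩
    ∑ n g + h (i + n)    ≡⟨ cong (∑ n g +_) (periodic i) ⟩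
    ∑ n g + g 0          ∎

∑-even-odd : ∀ k (h : ℕ → ℕ) →
  ∑ (suc (2 * k)) h ≡ ∑ (suc k) (λ t → h (2 * t)) + ∑ k (λ t → h (suc (2 * t)))
∑-even-odd zero h = sym (+-identityʳ (h 0 + 0))
∑-even-odd (suc k) h = begin
  ∑ (suc (2 * suc k)) h
    ≡⟨ cong (λ z → ∑ (suc z) h) (*-suc 2 k) ⟩
  h 0 + (h 1 + (h 2 + ∑ (2 * k) (h ∘ suc ∘ suc ∘ suc)))
    ≡⟨ cong (λ z → h 0 + (h 1 + z)) (∑-even-odd k (h ∘ suc ∘ suc)) ⟩
  h 0 + (h 1 + (E + O))
    ≡⟨ cong (h 0 +_) (x∙yz≈y∙xz (h 1) E O) ⟩
  h 0 + (E + (h 1 + O))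
    ≡⟨ sym (+-assoc (h 0) E _) ⟩
  (h 0 + E) + (h 1 + O)
    ≡⟨ cong₂ (λ x y → (h 0 + x) + (h 1 + y))
         (∑-cong (suc k) (λ t _ → cong h (sym (*-suc 2 t))))
         (∑-cong k (λ t _ → cong (h ∘ suc) (sym (*-suc 2 t)))) ⟩
  ∑ (suc (suc k)) (λ t → h (2 * t)) + ∑ (suc k) (λ t → h (suc (2 * t)))
    ∎
  where
  open ≡-Reasoning
  E O : ℕ
  E = ∑ (suc k) (λ t → h (suc (suc (2 * t))))
  O = ∑ k (λ t → h (suc (suc (suc (2 * t)))))

∑≡0⇒≡0 : ∀ n (h : ℕ → ℕ) → ∑ n h ≡ 0 → ∀ m → m < n → h m ≡ 0
∑≡0⇒≡0 (suc n) h e zero _ = m+n≡0⇒m≡0 (h 0) e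
∑≡0⇒≡0 (suc n) h e (suc m) (s<s m<n) = ∑≡0⇒≡0 n (h ∘ suc) (m+n≡0⇒n≡0 (h 0) e) m m<n

∑>0⇒∃>0 : ∀ n (h : ℕ → ℕ) → 0 < ∑ n h → ∃[ m ] m < n × 0 < h m
∑>0⇒∃>0 (suc n) h pos with h 0 in eq
... | suc _ = 0 , z<s , subst (0 <_) (sym eq) z<s
... | zero with ∑>0⇒∃>0 n (h ∘ suc) pos
...   | m , m<n , h[m]>0 = suc m , s<s m<n , h[m]>0

⟦xor⟧+2⟦∧⟧ : ∀ a b → ⟦ a xor b ⟧ + 2 * ⟦ a ∧ b ⟧ ≡ ⟦ a ⟧ + ⟦ b ⟧
⟦xor⟧+2⟦∧⟧ true true = refl
⟦xor⟧+2⟦∧⟧ true false = refl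
⟦xor⟧+2⟦∧⟧ false true = refl
⟦xor⟧+2⟦∧⟧ false false = refl

⟦∧⟧≤ˡ : ∀ a b → ⟦ a ∧ b ⟧ ≤ ⟦ a ⟧
⟦∧⟧≤ˡ true true = ≤-refl
⟦∧⟧≤ˡ true false = z≤n
⟦∧⟧≤ˡ false _ = z≤n

⟦∧⟧≤ʳ : ∀ a b → ⟦ a ∧ b ⟧ ≤ ⟦ b ⟧
⟦∧⟧≤ʳ a b = subst (_≤ ⟦ b ⟧) (cong ⟦_⟧ (∧-comm b a)) (⟦∧⟧≤ˡ b a)

⟦∧⟧>0⇒both : ∀ a b → 0 < ⟦ a ∧ b ⟧ → a ≡ true × b ≡ true
⟦∧⟧>0⇒both true true _ = refl , refl

⟦xor⟧-triangle : ∀ a b c → ⟦ a xor c ⟧ ≤ ⟦ a xor b ⟧ + ⟦ b xor c ⟧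
⟦xor⟧-triangle true _ true = z≤n
⟦xor⟧-triangle false _ false = z≤n
⟦xor⟧-triangle true true false = s≤s z≤n
⟦xor⟧-triangle true false false = s≤s z≤n
⟦xor⟧-triangle false true true = s≤s z≤n
⟦xor⟧-triangle false false true = s≤s z≤n

⟦xor⟧≡0⇒≡ : ∀ a b → ⟦ a xor b ⟧ ≡ 0 → a ≡ b
⟦xor⟧≡0⇒≡ true true _ = refl
⟦xor⟧≡0⇒≡ false false _ = refl

⟦not⟧+⟦⟧≡1 : ∀ a → ⟦ not a ⟧ + ⟦ a ⟧ ≡ 1
⟦not⟧+⟦⟧≡1 true = refl
⟦not⟧+⟦⟧≡1 false = refl

not≡true⇒≢true : ∀ b → not b ≡ true → b ≢ true
not≡true⇒≢true true () _
not≡true⇒≢true false _ ()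

odd-⟦⟧ : ∀ b → odd ⟦ b ⟧ ≡ b
odd-⟦⟧ true = refl
odd-⟦⟧ false = refl

odd-+ : ∀ m n → odd (m + n) ≡ odd m xor odd n
odd-+ zero n = refl
odd-+ (suc m) n = trans (cong not (odd-+ m n)) (not-distribˡ-xor (odd m) (odd n))

odd-2* : ∀ k → odd (2 * k) ≡ false
odd-2* k = trans (odd-+ k (k + 0)) (trans (cong (λ x → odd k xor odd x) (+-identityʳ k)) (xor-same (odd k)))

odd-+2* : ∀ m k → odd (m + 2 * k) ≡ odd m
odd-+2* m k = trans (odd-+ m (2 * k)) (trans (cong (odd m xor_) (odd-2* k)) (xor-identityʳ (odd m)))

odd-2*+ : ∀ k m → odd (2 * k + m) ≡ odd m
odd-2*+ k m = trans (odd-+ (2 * k) m) (cong (_xor odd m) (odd-2* k))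

changes : ℕ → (ℕ → Bool) → ℕ
changes k g = ∑ k (λ t → ⟦ g t xor g (suc t) ⟧)

odd-changes : ∀ k g → odd (changes k g) ≡ g 0 xor g k
odd-changes zero g = sym (xor-same (g 0))
odd-changes (suc k) g = begin
  odd (⟦ g 0 xor g 1 ⟧ + changes k (g ∘ suc))           ≡⟨ odd-+ ⟦ g 0 xor g 1 ⟧ _ ⟩
  odd ⟦ g 0 xor g 1 ⟧ xor odd (changes k (g ∘ suc))       ≡⟨ cong₂ _xor_ (odd-⟦⟧ (g 0 xor g 1)) (odd-changes k (g ∘ suc)) ⟩
  (g 0 xor g 1) xor (g 1 xor g (suc k))                   ≡⟨ xor-assoc (g 0) (g 1) _ ⟩
  g 0 xor (g 1 xor (g 1 xor g (suc k)))                   ≡⟨ cong (g 0 xor_) (sym (xor-assoc (g 1) (g 1) _)) ⟩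
  g 0 xor ((g 1 xor g 1) xor g (suc k))                   ≡⟨ cong (λ x → g 0 xor (x xor g (suc k))) (xor-same (g 1)) ⟩
  g 0 xor g (suc k)                                       ∎
  where open ≡-Reasoning

changes≡0⇒constant : ∀ k g → changes k g ≡ 0 → ∀ t → t ≤ k → g t ≡ g 0
changes≡0⇒constant k g none zero _ = refl
changes≡0⇒constant k g none (suc t) t<k =
  trans (sym (⟦xor⟧≡0⇒≡ (g t) (g (suc t)) (∑≡0⇒≡0 k _ none t t<k)))
        (changes≡0⇒constant k g none t (<⇒≤ t<k))

even-or-odd : ∀ d → ∃[ t ] (d ≡ 2 * t ⊎ d ≡ suc (2 * t))
even-or-odd zero = 0 , inj₁ refl
even-or-odd (suc d) with even-or-odd d
... | t , inj₁ d≡2t = t , inj₂ (cong suc d≡2t)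
... | t , inj₂ d≡1+2t = suc t , inj₁ (trans (cong suc d≡1+2t) (sym (*-suc 2 t)))

m+n≡2⇒m≡0⊎n≡0 : ∀ a b → odd a ≡ false → a + b ≡ 2 → a ≡ 0 ⊎ b ≡ 0
m+n≡2⇒m≡0⊎n≡0 zero b _ _ = inj₁ refl
m+n≡2⇒m≡0⊎n≡0 (suc (suc a)) b _ a+b≡0 = inj₂ (m+n≡0⇒n≡0 a (suc-injective (suc-injective a+b≡0)))

even∧≢0⇒≡2*suc : ∀ a → odd a ≡ false → a ≢ 0 → ∃[ x ] a ≡ 2 * suc x
even∧≢0⇒≡2*suc a even a≢0 with even-or-odd a
... | zero , inj₁ a≡0 = ⊥-elim (a≢0 a≡0)
... | suc x , inj₁ a≡2x = x , a≡2x
... | t , inj₂ refl with trans (sym even) (cong not (odd-2* t))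
...   | ()

odd⇒≡1+2* : ∀ b → odd b ≡ true → ∃[ z ] b ≡ suc (2 * z)
odd⇒≡1+2* b odd-b with even-or-odd b
... | t , inj₂ b≡1+2t = t , b≡1+2t
... | t , inj₁ refl with trans (sym odd-b) (odd-2* t)
...   | ()

7≤even+odd+even : ∀ x y z → ¬ (x ≡ 0 × y ≡ 0 × z ≡ 0) → 7 ≤ 2 * suc x + suc (2 * y) + 2 * suc z
7≤even+odd+even x y z not-all-zero = subst (7 ≤_) (sym (regroup x y z)) (+-monoʳ-≤ 5 (*-monoʳ-≤ 2 1≤x+y+z))
  where
  regroup : ∀ x y z → 2 * suc x + suc (2 * y) + 2 * suc z ≡ 5 + 2 * (x + y + z)
  regroup = solve-∀
  1≤x+y+z : 1 ≤ x + y + z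
  1≤x+y+z with x + y + z in x+y+z≡0
  ... | suc _ = s≤s z≤n
  ... | zero = ⊥-elim (not-all-zero (m+n≡0⇒m≡0 x x+y≡0 , m+n≡0⇒n≡0 x x+y≡0 , m+n≡0⇒n≡0 (x + y) x+y+z≡0))
    where
    x+y≡0 : x + y ≡ 0
    x+y≡0 = m+n≡0⇒m≡0 (x + y) x+y+z≡0

cyclic-offset : ∀ {n b j} → b ≤ n → j < n → ∃[ d ] d < n × (d + b ≡ j ⊎ d + b ≡ j + n)
cyclic-offset {n} {b} {j} b≤n j<n with b ≤? j
... | yes b≤j = j ∸ b , ≤-<-trans (m∸n≤m j b) j<n , inj₁ (m∸n+n≡m b≤j)
... | no b≰j = j + n ∸ b , +-cancelʳ-< b _ n d+b<n+b , inj₂ d+b≡j+n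
  where
  d+b≡j+n : j + n ∸ b + b ≡ j + n
  d+b≡j+n = m∸n+n≡m (≤-trans b≤n (m≤n+m n j))
  d+b<n+b : j + n ∸ b + b < n + b
  d+b<n+b = subst (_< n + b) (sym d+b≡j+n) (subst (j + n <_) (+-comm b n) (+-monoˡ-< n (≰⇒> b≰j)))

module Cyclic (n : ℕ) where

  Periodic : (ℕ → Bool) → Set
  Periodic r = ∀ m → r (m + n) ≡ r m

  rotate : ℕ → (ℕ → Bool) → ℕ → Bool
  rotate s r i = r (i + s)

  count : (ℕ → Bool) → ℕ
  count r = ∑ n (⟦_⟧ ∘ r)

  differ : (ℕ → Bool) → (ℕ → Bool) → ℕ
  differ r r′ = ∑ n (λ i → ⟦ r i xor r′ i ⟧)

  common : (ℕ → Bool) → (ℕ → Bool) → ℕ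
  common r r′ = ∑ n (λ i → ⟦ r i ∧ r′ i ⟧)

  cut : ℕ → (ℕ → Bool) → ℕ
  cut s r = differ r (rotate s r)

  rotate-periodic : ∀ {r} s → Periodic r → Periodic (rotate s r)
  rotate-periodic {r} s periodic m = trans (cong r (xy∙z≈xz∙y m n s)) (periodic (m + s))

  count-rotate : ∀ {r} s → Periodic r → count (rotate s r) ≡ count r
  count-rotate {r} s periodic = ∑-rotate n (⟦_⟧ ∘ r) (cong ⟦_⟧ ∘ periodic) s

  differ-rotate : ∀ {r r′} s → Periodic r → Periodic r′ → differ (rotate s r) (rotate s r′) ≡ differ r r′
  differ-rotate {r} {r′} s periodic periodic′ =
    ∑-rotate n (λ i → ⟦ r i xor r′ i ⟧) (λ m → cong₂ (λ a b → ⟦ a xor b ⟧) (periodic m) (periodic′ m)) s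

  differ+2*common : ∀ r r′ → differ r r′ + 2 * common r r′ ≡ count r + count r′
  differ+2*common r r′ = begin
    differ r r′ + 2 * common r r′
      ≡⟨ cong (differ r r′ +_) (∑-distribˡ-* n 2 (λ i → ⟦ r i ∧ r′ i ⟧)) ⟨
    differ r r′ + ∑ n (λ i → 2 * ⟦ r i ∧ r′ i ⟧)
      ≡⟨ ∑-distrib-+ n (λ i → ⟦ r i xor r′ i ⟧) _ ⟨
    ∑ n (λ i → ⟦ r i xor r′ i ⟧ + 2 * ⟦ r i ∧ r′ i ⟧)
      ≡⟨ ∑-cong n (λ i _ → ⟦xor⟧+2⟦∧⟧ (r i) (r′ i)) ⟩
    ∑ n (λ i → ⟦ r i ⟧ + ⟦ r′ i ⟧)
      ≡⟨ ∑-distrib-+ n (⟦_⟧ ∘ r) (⟦_⟧ ∘ r′) ⟩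
    count r + count r′
      ∎
    where open ≡-Reasoning

  common≤ˡ : ∀ r r′ → common r r′ ≤ count r
  common≤ˡ r r′ = ∑-mono-≤ n (λ i _ → ⟦∧⟧≤ˡ (r i) (r′ i))

  common≤ʳ : ∀ r r′ → common r r′ ≤ count r′
  common≤ʳ r r′ = ∑-mono-≤ n (λ i _ → ⟦∧⟧≤ʳ (r i) (r′ i))

  differ-comm : ∀ r r′ → differ r r′ ≡ differ r′ r
  differ-comm r r′ = ∑-cong n (λ i _ → cong ⟦_⟧ (xor-comm (r i) (r′ i)))

  differ-triangle : ∀ r₁ r₂ r₃ → differ r₁ r₃ ≤ differ r₁ r₂ + differ r₂ r₃
  differ-triangle r₁ r₂ r₃ = ≤-trans (∑-mono-≤ n (λ i _ → ⟦xor⟧-triangle (r₁ i) (r₂ i) (r₃ i)))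
                                     (≤-reflexive (∑-distrib-+ n _ _))

  count-not : ∀ r → count (not ∘ r) + count r ≡ n
  count-not r = begin
    count (not ∘ r) + count r           ≡⟨ ∑-distrib-+ n _ _ ⟨
    ∑ n (λ i → ⟦ not (r i) ⟧ + ⟦ r i ⟧) ≡⟨ ∑-cong n (λ i _ → ⟦not⟧+⟦⟧≡1 (r i)) ⟩
    ∑ n (λ _ → 1)                       ≡⟨ ∑-const n 1 ⟩
    n * 1                               ≡⟨ *-identityʳ n ⟩
    n                                   ∎
    where open ≡-Reasoning

  cut-not : ∀ s r → cut s (not ∘ r) ≡ cut s r
  cut-not s r = ∑-cong n (λ i _ → cong ⟦_⟧ (xor-annihilates-not (r i) (r (i + s))))

  odd-cut : ∀ {r} s → Periodic r → odd (cut s r) ≡ false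
  odd-cut {r} s periodic = begin
    odd (cut s r)                       ≡⟨ odd-+2* (cut s r) (common r (rotate s r)) ⟨
    odd (cut s r + 2 * common r (rotate s r))
                                        ≡⟨ cong odd (differ+2*common r (rotate s r)) ⟩
    odd (count r + count (rotate s r))  ≡⟨ cong (λ x → odd (count r + x)) (count-rotate s periodic) ⟩
    odd (count r + count r)             ≡⟨ odd-+ (count r) (count r) ⟩
    odd (count r) xor odd (count r)     ≡⟨ xor-same (odd (count r)) ⟩
    false                               ∎
    where open ≡-Reasoning

  common≡0⇒differ≡ : ∀ r r′ → common r r′ ≡ 0 → differ r r′ ≡ count r + count r′
  common≡0⇒differ≡ r r′ none =
    trans (sym (+-identityʳ _)) (trans (cong (λ c → differ r r′ + 2 * c) (sym none)) (differ+2*common r r′))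

  differ-constant : ∀ {r} r′ b → (∀ m → m < n → r m ≡ b) → count r + count r′ ≡ n → differ r r′ ≡ n
  differ-constant {r} r′ b constant balanced =
    trans (common≡0⇒differ≡ r r′ (n≤0⇒n≡0 (no-common b count-constant))) balanced
    where
    count-constant : count r ≡ n * ⟦ b ⟧
    count-constant = trans (∑-cong n (λ m m<n → cong ⟦_⟧ (constant m m<n))) (∑-const n ⟦ b ⟧)
    no-common : ∀ b → count r ≡ n * ⟦ b ⟧ → common r r′ ≤ 0
    no-common false all-false = ≤-trans (common≤ˡ r r′) (≤-reflexive (trans all-false (*-zeroʳ n)))
    no-common true all-true = ≤-trans (common≤ʳ r r′) (≤-reflexive none′)
      where
      none′ : count r′ ≡ 0
      none′ = +-cancelˡ-≡ n (count r′) 0 (begin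
        n + count r′        ≡⟨ cong (_+ count r′) (trans all-true (*-identityʳ n)) ⟨
        count r + count r′  ≡⟨ balanced ⟩
        n                   ≡⟨ +-identityʳ n ⟨
        n + 0               ∎)
        where open ≡-Reasoning

  cut<2*count⇒pair : ∀ {r} s → Periodic r → cut s r < 2 * count r →
                     ∃[ i ] i < n × r i ≡ true × r (i + s) ≡ true
  cut<2*count⇒pair {r} s periodic short with ∑>0⇒∃>0 n (λ i → ⟦ r i ∧ r (i + s) ⟧) some-common
    where
    some-common : 0 < common r (rotate s r)
    some-common with common r (rotate s r) in none
    ... | suc _ = z<s
    ... | zero = ⊥-elim (<-irrefl (begin
      cut s r                             ≡⟨ common≡0⇒differ≡ r (rotate s r) none ⟩
      count r + count (rotate s r)        ≡⟨ cong (count r +_) (trans (count-rotate s periodic) (sym (+-identityʳ _))) ⟩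
      2 * count r                         ∎) short)
      where open ≡-Reasoning
  ... | i , i<n , pos = i , i<n , ⟦∧⟧>0⇒both (r i) (r (i + s)) pos

  cut≡0⇒invariant : ∀ s r → cut s r ≡ 0 → ∀ m → m < n → r (m + s) ≡ r m
  cut≡0⇒invariant s r none m m<n = sym (⟦xor⟧≡0⇒≡ (r m) (r (m + s)) (∑≡0⇒≡0 n _ none m m<n))

  cut₁≡0⇒constant : ∀ r → cut 1 r ≡ 0 → ∀ m → m < n → r m ≡ r 0
  cut₁≡0⇒constant r none zero _ = refl
  cut₁≡0⇒constant r none (suc m) m+1<n =
    trans (cong r (+-comm 1 m)) (trans (cut≡0⇒invariant 1 r none m m<n) (cut₁≡0⇒constant r none m m<n))
    where
    m<n : m < n
    m<n = <-trans (n<1+n m) m+1<n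

  cut-interval : ∀ s c d r → Periodic r → n ≡ (s + c) + (s + d) →
                 (∀ x → x < s + c → r x ≡ true) → (∀ x → x < s + d → r (s + c + x) ≡ false) →
                 cut s r ≡ s + s
  cut-interval s c d r periodic n≡ r-true r-false = begin
    ∑ n h
      ≡⟨ cong (λ z → ∑ z h) n≡ ⟩
    ∑ (a + (s + d)) h
      ≡⟨ ∑-++ a (s + d) h ⟩
    ∑ a h + ∑ (s + d) (λ x → h (a + x))
      ≡⟨ cong₂ (λ u v → ∑ u h + ∑ v (λ x → h (a + x))) (+-comm s c) (+-comm s d) ⟩
    ∑ (c + s) h + ∑ (d + s) (λ x → h (a + x))
      ≡⟨ cong₂ _+_ (∑-++ c s h) (∑-++ d s (λ x → h (a + x))) ⟩
    (∑ c h + ∑ s (λ u → h (c + u))) + (∑ d (λ x → h (a + x)) + ∑ s (λ u → h (a + (d + u))))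
      ≡⟨ cong₂ _+_ (cong₂ _+_ (∑-const-on c h 0 both-true) (∑-const-on s _ 1 leaving))
                   (cong₂ _+_ (∑-const-on d _ 0 both-false) (∑-const-on s _ 1 entering)) ⟩
    (c * 0 + s * 1) + (d * 0 + s * 1)
      ≡⟨ tally c d s ⟩
    s + s
      ∎
    where
    open ≡-Reasoning
    a : ℕ
    a = s + c
    h : ℕ → ℕ
    h m = ⟦ r m xor r (m + s) ⟧
    tally : ∀ c d s → (c * 0 + s * 1) + (d * 0 + s * 1) ≡ s + s
    tally = solve-∀
    leaving-shift : ∀ s c u → c + u + s ≡ s + c + u
    leaving-shift = solve-∀
    entering-wrap : ∀ s c d u → s + c + (d + u) + s ≡ u + (s + c + (s + d))
    entering-wrap = solve-∀
    values : ∀ {m x y} → r m ≡ x → r (m + s) ≡ y → h m ≡ ⟦ x xor y ⟧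
    values = cong₂ (λ x y → ⟦ x xor y ⟧)
    both-true : ∀ m → m < c → h m ≡ 0
    both-true m m<c = values (r-true m (<-≤-trans m<c (m≤n+m c s)))
                             (r-true (m + s) (subst (m + s <_) (+-comm c s) (+-monoˡ-< s m<c)))
    leaving : ∀ u → u < s → h (c + u) ≡ 1
    leaving u u<s = values (r-true (c + u) (subst (c + u <_) (+-comm c s) (+-monoʳ-< c u<s)))
                           (trans (cong r (leaving-shift s c u)) (r-false u (<-≤-trans u<s (m≤m+n s d))))
    both-false : ∀ x → x < d → h (a + x) ≡ 0
    both-false x x<d = values (r-false x (<-≤-trans x<d (m≤n+m d s)))
                              (trans (cong r (+-assoc a x s)) (r-false (x + s) (subst (x + s <_) (+-comm d s) (+-monoˡ-< s x<d))))
    entering : ∀ u → u < s → h (a + (d + u)) ≡ 1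
    entering u u<s = values (r-false (d + u) (subst (d + u <_) (+-comm d s) (+-monoʳ-< d u<s)))
                            (trans (cong r (trans (entering-wrap s c d u) (cong (u +_) (sym n≡))))
                                   (trans (periodic u) (r-true u (<-≤-trans u<s (m≤m+n s c)))))

module OddCycle (l : ℕ) where

  n : ℕ
  n = suc (2 * l)

  open Cyclic n

  2*t<n⇒t≤l : ∀ t → 2 * t < n → t ≤ l
  2*t<n⇒t≤l t 2t<n = *-cancelˡ-≤ 2 (≤-pred 2t<n)

  cut₂≡0⇒constant : ∀ r → Periodic r → cut 2 r ≡ 0 → ∀ m → m < n → r m ≡ r 0
  cut₂≡0⇒constant r periodic none = constant
    where
    invariant : ∀ m → m < n → r (m + 2) ≡ r m
    invariant = cut≡0⇒invariant 2 r none
    odd-constant : ∀ t → t ≤ l → r (suc (2 * t)) ≡ r 1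
    odd-constant zero _ = refl
    odd-constant (suc t) t<l = begin
      r (suc (2 * suc t))  ≡⟨ cong (r ∘ suc) (trans (*-suc 2 t) (+-comm 2 (2 * t))) ⟩
      r (suc (2 * t) + 2)  ≡⟨ invariant (suc (2 * t)) (s<s (*-monoʳ-< 2 t<l)) ⟩
      r (suc (2 * t))      ≡⟨ odd-constant t (<⇒≤ t<l) ⟩
      r 1                  ∎
      where open ≡-Reasoning
    constant : ∀ m → m < n → r m ≡ r 0
    constant zero _ = refl
    constant (suc zero) _ = trans (sym (odd-constant l ≤-refl)) (periodic 0)
    constant (suc (suc m)) m+2<n = trans (cong r (+-comm 2 m)) (trans (invariant m m<n) (constant m m<n))
      where
      m<n : m < n
      m<n = <-trans (n<1+n m) (<-trans (n<1+n (suc m)) m+2<n)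

  arc-meets-edge : ∀ (r : ℕ → Bool) b → (∀ t → t ≤ l → r (2 * t + b) ≡ true) →
                   ∀ d → d < n → r (d + b) ≡ true ⊎ r (suc d + b) ≡ true
  arc-meets-edge r b arc d d<n with even-or-odd d
  ... | t , inj₁ refl = inj₁ (arc t (2*t<n⇒t≤l t d<n))
  ... | t , inj₂ refl = inj₂ (subst (λ x → r (x + b) ≡ true) (*-suc 2 t) (arc (suc t) (2*t<n⇒t≤l (suc t) 2t+2<n)))
    where
    2t+2<n : 2 * suc t < n
    2t+2<n = s≤s (*-monoʳ-≤ 2 (*-cancelˡ-< 2 t l (≤-pred d<n)))

  arc-meets-every-edge : ∀ r b → Periodic r → b ≤ n → (∀ t → t ≤ l → r (2 * t + b) ≡ true) →
                         ∀ j → j < n → r j ≡ true ⊎ r (suc j) ≡ true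
  arc-meets-every-edge r b periodic b≤n arc j j<n with cyclic-offset b≤n j<n
  ... | d , d<n , d+b∼j =
    Sum.map (trans (sym (same-class d+b∼j))) (trans (sym (same-class (Sum.map (cong suc) (cong suc) d+b∼j))))
            (arc-meets-edge r b arc d d<n)
    where
    same-class : ∀ {x y} → x ≡ y ⊎ x ≡ y + n → r x ≡ r y
    same-class (inj₁ x≡y) = cong r x≡y
    same-class {y = y} (inj₂ x≡y+n) = trans (cong r x≡y+n) (periodic y)

  -- As 2 (l + 1) = n + 1, the inner cycle from i reaches i + 1 after l + 1 steps. This walk
  -- (evens) and the rest of the cycle (odds) both join two true vertices, so each has an even
  -- share of the two changes, and one of them has none.
  cut₂≡2⇒arc : ∀ r → Periodic r → cut 2 r ≡ 2 → ∀ i → r i ≡ true → r (suc i) ≡ true →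
               (∀ t → t ≤ l → r (2 * t + i) ≡ true) ⊎ (∀ t → t ≤ l → r (2 * t + suc i) ≡ true)
  cut₂≡2⇒arc r periodic cut≡2 i r[i] r[1+i] =
    Sum.map evens-constant odds-constant (m+n≡2⇒m≡0⊎n≡0 (changes (suc l) evens) (changes l odds) evens-even split)
    where
    evens odds : ℕ → Bool
    evens t = r (2 * t + i)
    odds t = r (2 * t + suc i)
    h : ℕ → ℕ
    h m = ⟦ r m xor r (m + 2) ⟧
    even-step : ∀ t i → 2 * t + i + 2 ≡ 2 * suc t + i
    even-step = solve-∀
    odd-step : ∀ t i → suc (2 * t) + i + 2 ≡ 2 * suc t + suc i
    odd-step = solve-∀
    evens-closed : ∀ l i → 2 * suc l + i ≡ suc i + suc (2 * l)
    evens-closed = solve-∀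
    evens-even : odd (changes (suc l) evens) ≡ false
    evens-even = begin
      odd (changes (suc l) evens)  ≡⟨ odd-changes (suc l) evens ⟩
      r i xor evens (suc l)        ≡⟨ cong₂ _xor_ r[i] (trans (cong r (evens-closed l i)) (trans (periodic (suc i)) r[1+i])) ⟩
      true xor true                ≡⟨⟩
      false                        ∎
      where open ≡-Reasoning
    split : changes (suc l) evens + changes l odds ≡ 2
    split = begin
      changes (suc l) evens + changes l odds
        ≡⟨ cong₂ _+_ (∑-cong (suc l) (λ t _ → cong (λ x → ⟦ evens t xor r x ⟧) (even-step t i)))
                     (∑-cong l (λ t _ → cong₂ (λ x y → ⟦ r x xor r y ⟧) (sym (+-suc (2 * t) i)) (odd-step t i))) ⟨
      ∑ (suc l) (λ t → h (2 * t + i)) + ∑ l (λ t → h (suc (2 * t) + i))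
        ≡⟨ ∑-even-odd l (λ m → h (m + i)) ⟨
      ∑ n (λ m → h (m + i))
        ≡⟨ ∑-rotate n h (λ m → cong₂ (λ a b → ⟦ a xor b ⟧) (periodic m) (rotate-periodic 2 periodic m)) i ⟩
      cut 2 r
        ≡⟨ cut≡2 ⟩
      2 ∎
      where open ≡-Reasoning
    evens-constant : changes (suc l) evens ≡ 0 → ∀ t → t ≤ l → evens t ≡ true
    evens-constant none t t≤l = trans (changes≡0⇒constant (suc l) evens none t (m≤n⇒m≤1+n t≤l)) r[i]
    odds-constant : changes l odds ≡ 0 → ∀ t → t ≤ l → odds t ≡ true
    odds-constant none t t≤l = trans (changes≡0⇒constant l odds none t t≤l) r[1+i]

  petersen-cost : (ℕ → Bool) → (ℕ → Bool) → ℕ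
  petersen-cost p q = cut 1 p + differ p q + cut 2 q

  odd-differ : ∀ p q → count p + count q ≡ n → odd (differ p q) ≡ true
  odd-differ p q balanced = begin
    odd (differ p q)                   ≡⟨ odd-+2* (differ p q) (common p q) ⟨
    odd (differ p q + 2 * common p q)  ≡⟨ cong odd (trans (differ+2*common p q) balanced) ⟩
    not (odd (2 * l))                  ≡⟨ cong not (odd-2* l) ⟩
    true                               ∎
    where open ≡-Reasoning

  no-cost-2+1+2 : 3 ≤ l → ∀ p q → Periodic p → Periodic q → count p + count q ≡ n →
                  cut 1 p ≡ 2 → differ p q ≡ 1 → cut 2 q ≡ 2 → ⊥
  no-cost-2+1+2 3≤l p q p-periodic q-periodic balanced O≡2 X≡1 I≡2
    with cut<2*count⇒pair 1 q-periodic (short-cut q cut₁q≤4 3≤count-q)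
       | cut<2*count⇒pair 1 (cong not ∘ q-periodic)
           (short-cut (not ∘ q) (subst (_≤ 4) (sym (cut-not 1 q)) cut₁q≤4) 3≤count-not-q)
    where
    common≡l : common p q ≡ l
    common≡l = *-cancelˡ-≡ _ _ 2 (suc-injective (trans (cong (_+ 2 * common p q) (sym X≡1))
                                                      (trans (differ+2*common p q) balanced)))
    3≤count-q : 3 ≤ count q
    3≤count-q = ≤-trans 3≤l (subst (_≤ count q) common≡l (common≤ʳ p q))
    3≤count-not-q : 3 ≤ count (not ∘ q)
    3≤count-not-q = ≤-trans 3≤l (subst (_≤ count (not ∘ q)) common≡l (≤-trans (common≤ˡ p q) (≤-reflexive
                      (+-cancelʳ-≡ (count q) _ _ (trans balanced (sym (count-not q)))))))
    cut₁q≤4 : cut 1 q ≤ 4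
    cut₁q≤4 = begin
      cut 1 q
        ≤⟨ differ-triangle q p (rotate 1 q) ⟩
      differ q p + differ p (rotate 1 q)
        ≤⟨ +-monoʳ-≤ (differ q p) (differ-triangle p (rotate 1 p) (rotate 1 q)) ⟩
      differ q p + (cut 1 p + differ (rotate 1 p) (rotate 1 q))
        ≡⟨ cong₂ (λ a b → a + (cut 1 p + b)) (differ-comm q p) (differ-rotate 1 p-periodic q-periodic) ⟩
      differ p q + (cut 1 p + differ p q)
        ≡⟨ cong₂ (λ a b → a + (b + a)) X≡1 O≡2 ⟩
      4 ∎
      where open ≤-Reasoning
    short-cut : ∀ r → cut 1 r ≤ 4 → 3 ≤ count r → cut 1 r < 2 * count r
    short-cut r cut≤4 3≤count = ≤-<-trans cut≤4 (≤-trans (m≤m+n 5 1) (*-monoʳ-≤ 2 3≤count))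
  ... | i , i<n , q[i] , q[i+1] | j , j<n , ¬q[j] , ¬q[j+1] =
    [ not≡true⇒≢true (q j) ¬q[j] , not≡true⇒≢true (q (suc j)) (trans (cong (not ∘ q) (+-comm 1 j)) ¬q[j+1]) ]
      (from-arc (cut₂≡2⇒arc q q-periodic I≡2 i q[i] (trans (cong q (+-comm 1 i)) q[i+1])))
    where
    from-arc : (∀ t → t ≤ l → q (2 * t + i) ≡ true) ⊎ (∀ t → t ≤ l → q (2 * t + suc i) ≡ true) →
               q j ≡ true ⊎ q (suc j) ≡ true
    from-arc (inj₁ arc) = arc-meets-every-edge q i q-periodic (<⇒≤ i<n) arc j j<n
    from-arc (inj₂ arc) = arc-meets-every-edge q (suc i) q-periodic i<n arc j j<n

  petersen-cost≥7 : 3 ≤ l → ∀ p q → Periodic p → Periodic q → count p + count q ≡ n → 7 ≤ petersen-cost p q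
  petersen-cost≥7 3≤l p q p-periodic q-periodic balanced = by-cases (cut 1 p ≟ 0) (cut 2 q ≟ 0)
    where
    7≤n : 7 ≤ n
    7≤n = s≤s (*-monoʳ-≤ 2 3≤l)
    all-edges-at : differ p q ≡ n → 7 ≤ petersen-cost p q
    all-edges-at X≡n = ≤-trans 7≤n (≤-trans (≤-reflexive (sym X≡n))
                       (≤-trans (m≤n+m (differ p q) (cut 1 p)) (m≤m+n _ (cut 2 q))))
    by-cases : Dec (cut 1 p ≡ 0) → Dec (cut 2 q ≡ 0) → 7 ≤ petersen-cost p q
    by-cases (yes O≡0) _ = all-edges-at (differ-constant q (p 0) (cut₁≡0⇒constant p O≡0) balanced)
    by-cases (no _) (yes I≡0) = all-edges-at (trans (differ-comm p q)
      (differ-constant p (q 0) (cut₂≡0⇒constant q q-periodic I≡0) (trans (+-comm (count q) (count p)) balanced)))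
    by-cases (no O≢0) (no I≢0)
      with even∧≢0⇒≡2*suc _ (odd-cut 1 p-periodic) O≢0 | odd⇒≡1+2* _ (odd-differ p q balanced)
         | even∧≢0⇒≡2*suc _ (odd-cut 2 q-periodic) I≢0
    ... | x , O≡ | y , X≡ | z , I≡ =
      subst (7 ≤_) (sym (cong₂ _+_ (cong₂ _+_ O≡ X≡) I≡)) (7≤even+odd+even x y z λ where
        (refl , refl , refl) → no-cost-2+1+2 3≤l p q p-periodic q-periodic balanced O≡ X≡ I≡)

sum-toℕ : ∀ k (h : ℕ → ℕ) → sum {k} (h ∘ toℕ) ≡ ∑ k h
sum-toℕ zero h = refl
sum-toℕ (suc k) h = cong (h 0 +_) (sum-toℕ k (h ∘ suc))

sum-↑ : ∀ a b (h : Fin (a + b) → ℕ) → sum h ≡ sum {a} (h ∘ (_↑ˡ b)) + sum {b} (h ∘ (a ↑ʳ_))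
sum-↑ zero b h = refl
sum-↑ (suc a) b h = trans (cong (h Fin.zero +_) (sum-↑ a b (h ∘ Fin.suc))) (sym (+-assoc (h Fin.zero) _ _))

∑-odd-suc : ∀ k → ∑ (k + k) (λ m → ⟦ odd (suc m) ⟧) ≡ k
∑-odd-suc zero = refl
∑-odd-suc (suc k) = cong suc (begin
  ∑ (k + suc k) (λ m → ⟦ odd (suc (suc m)) ⟧)     ≡⟨ cong (λ z → ∑ z (λ m → ⟦ odd (suc (suc m)) ⟧)) (+-suc k k) ⟩
  ∑ (k + k) (λ m → ⟦ odd (suc (suc (suc m))) ⟧)   ≡⟨ ∑-cong (k + k) (λ m _ → cong ⟦_⟧ (not-involutive (odd (suc m)))) ⟩
  ∑ (k + k) (λ m → ⟦ odd (suc m) ⟧)               ≡⟨ ∑-odd-suc k ⟩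
  k                                               ∎)
  where open ≡-Reasoning

oddEdges-++ : ∀ {V N} (xs ys : List (V × V)) (f : Labeling V N) →
              oddEdges (xs ++ ys) f ≡ oddEdges xs f + oddEdges ys f
oddEdges-++ [] ys f = refl
oddEdges-++ ((x , y) ∷ xs) ys f with odd (label f x) xor odd (label f y)
... | true = cong suc (oddEdges-++ xs ys f)
... | false = oddEdges-++ xs ys f

oddEdges-∷ : ∀ {V N} x y (es : List (V × V)) (f : Labeling V N) →
             oddEdges ((x , y) ∷ es) f ≡ ⟦ odd (label f x) xor odd (label f y) ⟧ + oddEdges es f
oddEdges-∷ x y es f with odd (label f x) xor odd (label f y)
... | true = refl
... | false = refl

oddEdges-concatMap : ∀ {V N} {A : Set} (g : A → List (V × V)) (f : Labeling V N) k (F : Fin k → A) →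
                     oddEdges (concatMap g (tabulate F)) f ≡ sum {k} (λ i → oddEdges (g (F i)) f)
oddEdges-concatMap g f zero F = refl
oddEdges-concatMap g f (suc k) F =
  trans (oddEdges-++ (g (F Fin.zero)) _ f) (cong (oddEdges (g (F Fin.zero)) f +_) (oddEdges-concatMap g f k (F ∘ Fin.suc)))

module PetersenLabeling (n : ℕ) .{{_ : NonZero n}} where

  open Cyclic n

  outer inner : Labeling (PVertex n) (n + n) → ℕ → Bool
  outer f m = odd (label f (inj₁ (m mod n)))
  inner f m = odd (label f (inj₂ (m mod n)))

  toℕ-mod : ∀ (i : Fin n) → toℕ i mod n ≡ i
  toℕ-mod i = toℕ-injective (trans (toℕ-fromℕ< _) (m<n⇒m%n≡m (toℕ<n i)))

  mod-periodic : ∀ m → (m + n) mod n ≡ m mod n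
  mod-periodic m = toℕ-injective (trans (toℕ-fromℕ< _) (trans ([m+n]%n≡m%n m n) (sym (toℕ-fromℕ< _))))

  outer-periodic : ∀ f → Periodic (outer f)
  outer-periodic f m = cong (λ i → odd (label f (inj₁ i))) (mod-periodic m)

  inner-periodic : ∀ f → Periodic (inner f)
  inner-periodic f m = cong (λ i → odd (label f (inj₂ i))) (mod-periodic m)

  oddEdges-PEdges : ∀ k f → oddEdges (PEdges n k) f ≡ cut 1 (outer f) + differ (outer f) (inner f) + cut k (inner f)
  oddEdges-PEdges k f = begin
    oddEdges (PEdges n k) f
      ≡⟨ oddEdges-concatMap edges-at f n (λ i → i) ⟩
    sum {n} (λ i → oddEdges (edges-at i) f)
      ≡⟨ sum-cong-≗ block ⟩
    sum {n} (H ∘ toℕ)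
      ≡⟨ sum-toℕ n H ⟩
    ∑ n H
      ≡⟨ ∑-distrib-+ n _ _ ⟩
    ∑ n (λ t → ⟦ p t xor p (t + 1) ⟧ + ⟦ p t xor q t ⟧) + cut k q
      ≡⟨ cong (_+ cut k q) (∑-distrib-+ n _ _) ⟩
    cut 1 p + differ p q + cut k q
      ∎
    where
    open ≡-Reasoning
    p q : ℕ → Bool
    p = outer f
    q = inner f
    edges-at : Fin n → List (PVertex n × PVertex n)
    edges-at i = (inj₁ i , inj₁ (i +ₘ 1)) ∷ (inj₁ i , inj₂ i) ∷ (inj₂ i , inj₂ (i +ₘ k)) ∷ []
    H : ℕ → ℕ
    H t = ⟦ p t xor p (t + 1) ⟧ + ⟦ p t xor q t ⟧ + ⟦ q t xor q (t + k) ⟧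
    edge : PVertex n → PVertex n → ℕ
    edge x y = ⟦ odd (label f x) xor odd (label f y) ⟧
    block : ∀ i → oddEdges (edges-at i) f ≡ H (toℕ i)
    block i = begin
      oddEdges (edges-at i) f
        ≡⟨ trans (oddEdges-∷ _ _ _ f) (cong (edge (inj₁ i) (inj₁ (i +ₘ 1)) +_)
             (trans (oddEdges-∷ _ _ _ f) (cong (edge (inj₁ i) (inj₂ i) +_) (oddEdges-∷ _ _ _ f)))) ⟩
      edge (inj₁ i) (inj₁ (i +ₘ 1)) + (edge (inj₁ i) (inj₂ i) + (edge (inj₂ i) (inj₂ (i +ₘ k)) + 0))
        ≡⟨ cong₂ (λ a b → ⟦ a xor p (t + 1) ⟧ + (⟦ a xor b ⟧ + (⟦ b xor q (t + k) ⟧ + 0)))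
                 (cong (λ j → odd (label f (inj₁ j))) (sym (toℕ-mod i)))
                 (cong (λ j → odd (label f (inj₂ j))) (sym (toℕ-mod i))) ⟩
      ⟦ p t xor p (t + 1) ⟧ + (⟦ p t xor q t ⟧ + (⟦ q t xor q (t + k) ⟧ + 0))
        ≡⟨ reassociate ⟦ p t xor p (t + 1) ⟧ ⟦ p t xor q t ⟧ ⟦ q t xor q (t + k) ⟧ ⟩
      H t ∎
      where
      t : ℕ
      t = toℕ i
      reassociate : ∀ a b c → a + (b + (c + 0)) ≡ a + b + c
      reassociate = solve-∀

  count-outer+count-inner : ∀ f → count (outer f) + count (inner f) ≡ n
  count-outer+count-inner f = begin
    count (outer f) + count (inner f)
      ≡⟨ cong₂ _+_ (sum-toℕ n (⟦_⟧ ∘ outer f)) (sum-toℕ n (⟦_⟧ ∘ inner f)) ⟨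
    sum {n} (⟦_⟧ ∘ outer f ∘ toℕ) + sum {n} (⟦_⟧ ∘ inner f ∘ toℕ)
      ≡⟨ cong₂ _+_ (sum-cong-≗ (cong (G ∘ inj₁) ∘ toℕ-mod)) (sum-cong-≗ (cong (G ∘ inj₂) ∘ toℕ-mod)) ⟩
    sum {n} (G ∘ inj₁) + sum {n} (G ∘ inj₂)
      ≡⟨ cong₂ _+_ (sum-cong-≗ (λ i → cong G (splitAt-↑ˡ n i n))) (sum-cong-≗ (λ i → cong G (splitAt-↑ʳ n n i))) ⟨
    sum {n} (G ∘ splitAt n ∘ (_↑ˡ n)) + sum {n} (G ∘ splitAt n ∘ (n ↑ʳ_))
      ≡⟨ sum-↑ n n (G ∘ splitAt n) ⟨
    sum {n + n} (G ∘ splitAt n)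
      ≡⟨ sum-permute (λ k → ⟦ odd (suc (toℕ k)) ⟧) (↔-trans +↔⊎ f) ⟨
    sum {n + n} (λ k → ⟦ odd (suc (toℕ k)) ⟧)
      ≡⟨ sum-toℕ (n + n) (λ m → ⟦ odd (suc m) ⟧) ⟩
    ∑ (n + n) (λ m → ⟦ odd (suc m) ⟧)
      ≡⟨ ∑-odd-suc n ⟩
    n ∎
    where
    open ≡-Reasoning
    G : PVertex n → ℕ
    G x = ⟦ odd (label f x) ⟧

module Affine (n : ℕ) .{{_ : NonZero n}} where

  affine : ℕ → ℕ → Fin n → Fin n
  affine a c i = (a * toℕ i + c) mod n

  toℕ-affine-mod : ∀ a c x → x < n → toℕ (affine a c (x mod n)) ≡ (a * x + c) % n
  toℕ-affine-mod a c x x<n =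
    trans (toℕ-fromℕ< _) (cong (λ y → (a * y + c) % n) (trans (toℕ-fromℕ< _) (m<n⇒m%n≡m x<n)))

  %-absorbs : ∀ a c x → (a * (x % n) + c) % n ≡ (a * x + c) % n
  %-absorbs a c x = begin
    (a * (x % n) + c) % n                      ≡⟨ [m+kn]%n≡m%n _ (a * (x / n)) n ⟨
    (a * (x % n) + c + a * (x / n) * n) % n    ≡⟨ cong (_% n) (expand a (x % n) (x / n) n c) ⟩
    (a * (x % n + x / n * n) + c) % n          ≡⟨ cong (λ y → (a * y + c) % n) (m≡m%n+[m/n]*n x n) ⟨
    (a * x + c) % n                            ∎
    where
    open ≡-Reasoning
    expand : ∀ a r q n c → a * r + c + a * q * n ≡ a * (r + q * n) + c
    expand = solve-∀

  affine-inverse : ∀ a c b d k₁ k₂ → a * b ≡ 1 + k₁ * n → a * d + c ≡ k₂ * n →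
                   ∀ j → affine a c (affine b d j) ≡ j
  affine-inverse a c b d k₁ k₂ ab≡ ad+c≡ j = toℕ-injective (begin
    toℕ (affine a c (affine b d j))            ≡⟨ toℕ-fromℕ< _ ⟩
    (a * toℕ (affine b d j) + c) % n           ≡⟨ cong (λ y → (a * y + c) % n) (toℕ-fromℕ< _) ⟩
    (a * ((b * J + d) % n) + c) % n            ≡⟨ %-absorbs a c (b * J + d) ⟩
    (a * (b * J + d) + c) % n                  ≡⟨ cong (_% n) (distribute a b J d c) ⟩
    ((a * b) * J + (a * d + c)) % n            ≡⟨ cong₂ (λ x y → (x * J + y) % n) ab≡ ad+c≡ ⟩
    ((1 + k₁ * n) * J + k₂ * n) % n            ≡⟨ cong (_% n) (collect k₁ n J k₂) ⟩
    (J + (k₁ * J + k₂) * n) % n                ≡⟨ [m+kn]%n≡m%n J (k₁ * J + k₂) n ⟩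
    J % n                                      ≡⟨ m<n⇒m%n≡m (toℕ<n j) ⟩
    J                                          ∎)
    where
    open ≡-Reasoning
    J : ℕ
    J = toℕ j
    distribute : ∀ a b J d c → a * (b * J + d) + c ≡ (a * b) * J + (a * d + c)
    distribute = solve-∀
    collect : ∀ k₁ n J k₂ → (1 + k₁ * n) * J + k₂ * n ≡ J + (k₁ * J + k₂) * n
    collect = solve-∀

  affine-↔ : ∀ a c b d k₁ k₂ k₃ → a * b ≡ 1 + k₁ * n → a * d + c ≡ k₂ * n → b * c + d ≡ k₃ * n → Fin n ↔ Fin n
  affine-↔ a c b d k₁ k₂ k₃ ab≡ ad+c≡ bc+d≡ = mk↔ₛ′ (affine a c) (affine b d)
    (affine-inverse a c b d k₁ k₂ ab≡ ad+c≡) (affine-inverse b d a c k₁ k₃ (trans (*-comm b a) ab≡) bc+d≡)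

module Witness (l : ℕ) where

  n : ℕ
  n = suc (2 * l)

  open Affine n
  open PetersenLabeling n

  2*[1+l]≡1+n : 2 * suc l ≡ 1 + 1 * n
  2*[1+l]≡1+n = identity l
    where
    identity : ∀ l → 2 * suc l ≡ 1 + 1 * suc (2 * l)
    identity = solve-∀

  doubling : Fin n ↔ Fin n
  doubling = affine-↔ 2 0 (suc l) 0 1 0 0 2*[1+l]≡1+n refl (trans (+-identityʳ (suc l * 0)) (*-zeroʳ (suc l)))

  doubling+1 : Fin n ↔ Fin n
  doubling+1 = affine-↔ 2 1 (suc l) l 1 1 1 2*[1+l]≡1+n (2l+1≡n l) ([1+l]+l≡n l)
    where
    2l+1≡n : ∀ l → 2 * l + 1 ≡ 1 * suc (2 * l)
    2l+1≡n = solve-∀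
    [1+l]+l≡n : ∀ l → suc l * 1 + l ≡ 1 * suc (2 * l)
    [1+l]+l≡n = solve-∀

  witness : Labeling (PVertex n) (n + n)
  witness = ↔-trans (doubling ⊎-↔ doubling+1) (↔-sym +↔⊎)

  p q : ℕ → Bool
  p = outer witness
  q = inner witness

  p≡ : ∀ x → x < n → p x ≡ not (odd ((2 * x + 0) % n))
  p≡ x x<n = cong (not ∘ odd) (trans (toℕ-↑ˡ _ n) (toℕ-affine-mod 2 0 x x<n))

  q≡ : ∀ x → x < n → q x ≡ odd ((2 * x + 1) % n)
  q≡ x x<n = begin
    odd (suc (toℕ (n ↑ʳ affine 2 1 (x mod n))))  ≡⟨ cong (odd ∘ suc) (toℕ-↑ʳ n _) ⟩
    odd (suc n + y)                             ≡⟨ odd-+ (suc n) y ⟩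
    odd (suc n) xor odd y                       ≡⟨ cong (_xor odd y) (trans (not-involutive (odd (2 * l))) (odd-2* l)) ⟩
    odd y                                       ≡⟨ cong odd (toℕ-affine-mod 2 1 x x<n) ⟩
    odd ((2 * x + 1) % n)                       ∎
    where
    open ≡-Reasoning
    y : ℕ
    y = toℕ (affine 2 1 (x mod n))

  l<n : l < n
  l<n = s≤s (m≤m+n l (l + 0))

  mod-wrap : ∀ y → y < n → (n + y) % n ≡ y
  mod-wrap y y<n = trans (cong (_% n) (+-comm n y)) (trans ([m+n]%n≡m%n y n) (m<n⇒m%n≡m y<n))

  p-true : ∀ x → x < suc l → p x ≡ true
  p-true x x<1+l = begin
    p x                          ≡⟨ p≡ x (≤-<-trans (≤-pred x<1+l) l<n) ⟩
    not (odd ((2 * x + 0) % n))  ≡⟨ cong (not ∘ odd) (m<n⇒m%n≡m (s≤s 2x+0≤2l)) ⟩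
    not (odd (2 * x + 0))        ≡⟨ cong not (odd-2*+ x 0) ⟩
    true                         ∎
    where
    open ≡-Reasoning
    2x+0≤2l : 2 * x + 0 ≤ 2 * l
    2x+0≤2l = ≤-trans (≤-reflexive (+-identityʳ _)) (*-monoʳ-≤ 2 (≤-pred x<1+l))

  p-false : ∀ x → x < l → p (suc l + x) ≡ false
  p-false x x<l = begin
    p (suc l + x)                            ≡⟨ p≡ (suc l + x) (s≤s (+-monoʳ-< l (subst (x <_) (sym (+-identityʳ l)) x<l))) ⟩
    not (odd ((2 * (suc l + x) + 0) % n))    ≡⟨ cong (λ y → not (odd (y % n))) (wrap l x) ⟩
    not (odd ((n + (2 * x + 1)) % n))        ≡⟨ cong (not ∘ odd) (mod-wrap (2 * x + 1) 2x+1<n) ⟩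
    not (odd (2 * x + 1))                    ≡⟨ cong not (odd-2*+ x 1) ⟩
    false                                    ∎
    where
    open ≡-Reasoning
    wrap : ∀ l x → 2 * (suc l + x) + 0 ≡ suc (2 * l) + (2 * x + 1)
    wrap = solve-∀
    2x+1<n : 2 * x + 1 < n
    2x+1<n = s≤s (subst (_≤ 2 * l) (+-comm 1 (2 * x)) (*-monoʳ-< 2 x<l))

  q-true : ∀ x → x < l → q x ≡ true
  q-true x x<l = begin
    q x                    ≡⟨ q≡ x (<-trans x<l l<n) ⟩
    odd ((2 * x + 1) % n)  ≡⟨ cong odd (m<n⇒m%n≡m (s≤s (subst (_≤ 2 * l) (+-comm 1 (2 * x)) (*-monoʳ-< 2 x<l)))) ⟩
    odd (2 * x + 1)        ≡⟨ odd-2*+ x 1 ⟩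
    true                   ∎
    where open ≡-Reasoning

  q-false : ∀ x → x < suc l → q (l + x) ≡ false
  q-false x x<1+l = begin
    q (l + x)                          ≡⟨ q≡ (l + x) (s≤s (+-monoʳ-≤ l (≤-trans (≤-pred x<1+l) (m≤m+n l 0)))) ⟩
    odd ((2 * (l + x) + 1) % n)        ≡⟨ cong (λ y → odd (y % n)) (wrap l x) ⟩
    odd ((n + 2 * x) % n)              ≡⟨ cong odd (mod-wrap (2 * x) (s≤s (*-monoʳ-≤ 2 (≤-pred x<1+l)))) ⟩
    odd (2 * x)                        ≡⟨ odd-2* x ⟩
    false                              ∎
    where
    open ≡-Reasoning
    wrap : ∀ l x → 2 * (l + x) + 1 ≡ suc (2 * l) + 2 * x
    wrap = solve-∀

  open Cyclic n

  differ-p-q : differ p q ≡ 1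
  differ-p-q = begin
    ∑ n h                                                   ≡⟨ cong (λ z → ∑ z h) (n≡l+[1+l] l) ⟩
    ∑ (l + suc l) h                                         ≡⟨ ∑-++ l (suc l) h ⟩
    ∑ l h + (h (l + 0) + ∑ l (λ x → h (l + suc x)))         ≡⟨ cong₂ (λ a b → a + (h (l + 0) + b)) agree-low agree-high ⟩
    l * 0 + (h (l + 0) + l * 0)                             ≡⟨ cong₂ (λ a b → a + (b + a)) (*-zeroʳ l) differ-at-l ⟩
    1                                                       ∎
    where
    open ≡-Reasoning
    n≡l+[1+l] : ∀ l → suc (2 * l) ≡ l + suc l
    n≡l+[1+l] = solve-∀
    h : ℕ → ℕ
    h t = ⟦ p t xor q t ⟧
    agree-low : ∑ l h ≡ l * 0
    agree-low = ∑-const-on l h 0 (λ x x<l → cong₂ (λ a b → ⟦ a xor b ⟧) (p-true x (<-trans x<l (n<1+n l))) (q-true x x<l))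
    agree-high : ∑ l (λ x → h (l + suc x)) ≡ l * 0
    agree-high = ∑-const-on l _ 0 (λ x x<l → cong₂ (λ a b → ⟦ a xor b ⟧)
      (trans (cong p (+-suc l x)) (p-false x x<l)) (q-false (suc x) (s≤s x<l)))
    differ-at-l : h (l + 0) ≡ 1
    differ-at-l = cong₂ (λ a b → ⟦ a xor b ⟧) (p-true (l + 0) (s≤s (≤-reflexive (+-identityʳ l)))) (q-false 0 z<s)

witness-cost : ∀ {l} → 2 ≤ l → OddCycle.petersen-cost l (Witness.p l) (Witness.q l) ≡ 7
witness-cost {suc zero} (s≤s ())
witness-cost {suc (suc k)} _ = begin
  cut 1 p + differ p q + cut 2 q  ≡⟨ cong₂ (λ a b → a + differ p q + b) cut₁p≡2 cut₂q≡4 ⟩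
  2 + differ p q + 4              ≡⟨ cong (λ x → 2 + x + 4) differ-p-q ⟩
  7                               ∎
  where
  open ≡-Reasoning
  open Witness (suc (suc k))
  open Cyclic n
  open PetersenLabeling n
  n≡ : ∀ k → suc (2 * suc (suc k)) ≡ suc (suc (suc k)) + suc (suc k)
  n≡ = solve-∀
  n≡′ : ∀ k → suc (2 * suc (suc k)) ≡ suc (suc k) + suc (suc (suc k))
  n≡′ = solve-∀
  cut₁p≡2 : cut 1 p ≡ 2
  cut₁p≡2 = cut-interval 1 (suc (suc k)) (suc k) p (outer-periodic witness) (n≡ k) p-true p-false
  cut₂q≡4 : cut 2 q ≡ 4
  cut₂q≡4 = cut-interval 2 k (suc k) q (inner-periodic witness) (n≡′ k) q-true q-false

theorem4p8 : (l : ℕ) → 3 ≤ l → PetersenRnaIs (suc (2 * l)) 2 7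
theorem4p8 l 3≤l =
  (witness , trans (oddEdges-PEdges 2 witness) (witness-cost (≤-trans (n≤1+n 2) 3≤l))) ,
  λ f → subst (7 ≤_) (sym (oddEdges-PEdges 2 f))
          (petersen-cost≥7 3≤l (outer f) (inner f) (outer-periodic f) (inner-periodic f) (count-outer+count-inner f))
  where
  open OddCycle l using (n; petersen-cost≥7)
  open PetersenLabeling n
  open Witness l using (witness)
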